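{- Let $0\le j\le\ell-1$, let $C^{j+1}$ be a component of $C\langle\{\phi(1),\dots,\phi(j+1)\}\rangle$, and write $C^{j+1}=C^j_1\sqcup\cdots\sqcup C^j_{m}$ with $m=g_j/g_{j+1}$, where the $C^j_u$ are components of $C\langle\{\phi(1),\dots,\phi(j)\}\rangle$. Let $G'$ be the directed graph on $[m]$ in which $(u,v)$ is an arc if and only if there is a directed edge of length $\phi(j+1)$ starting in $C^j_u$ and ending in $C^j_v$. Then $G'$ is a directed cycle.
   Context: Setting: $n\ge3$, $V=[n]$ with arithmetic mod $n$, $d=\lfloor n/2\rfloor$; a symmetric circulant instance with stripe costs $c_1,\dots,c_d$. $\phi$ is a permutation of $[d]$ with $c_{\phi(1)}\le\dots\le c_{\phi(d)}$; $g_0=n$, $g_i=\gcd(\phi(i),g_{i-1})$; $\ell=\min\{i:g_i=1\}$; standing assumption $g_0>g_1>\dots>g_\ell=1$. For $T\subseteq[d]$, $C\langle T\rangle$ is the graph on $V$ containing exactly the edges $\{v,v+k\}$ with $k\in T$; the components of $C\langle\{\phi(1),\dots,\phi(i)\}\rangle$ are the residue classes of $V$ mod $g_i$. Directed edges: for each $v$ and $k\in[d]$, a directed edge $(v,v+k)$ of length $k$ (for $k=n/2$ both $(v,v+n/2)$ and $(v+n/2,v)$). -}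

module Defs where

open import Data.Nat using (ℕ; zero; suc; _+_; _*_; _≤_; _<_)
open import Data.Nat.DivMod using (_%_)
open import Data.Nat.GCD using (gcd)
open import Data.Fin using (Fin; toℕ)
open import Data.Product using (Σ; _×_; _,_)
open import Data.Sum using (_⊎_)
open import Relation.Binary.PropositionalEquality using (_≡_)
open import Function.Definitions using (Bijective)

-- φ is represented as a function ℕ → ℕ, only its values on 1..d matter.
-- φ is a permutation of [d] = {1,…,d}.
IsPermOf : (d : ℕ) → (ℕ → ℕ) → Set
IsPermOf d φ =
  (∀ i → 1 ≤ i → i ≤ d → (1 ≤ φ i × φ i ≤ d)) ×
  (∀ i i' → 1 ≤ i → i ≤ d → 1 ≤ i' → i' ≤ d → φ i ≡ φ i' → i ≡ i')

g : (n : ℕ) → (ℕ → ℕ) → ℕ → ℕ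
g n φ zero    = n
g n φ (suc i) = gcd (φ (suc i)) (g n φ i)

Prefix : (ℕ → ℕ) → ℕ → ℕ → Set
Prefix φ i k = Σ ℕ λ t → 1 ≤ t × t ≤ i × k ≡ φ t

-- undirected edge {x, x+k} (mod n) of C⟨T⟩ with k ∈ T
Adj : (n : ℕ) .{{_ : Data.Nat.NonZero n}} → (ℕ → Set) → ℕ → ℕ → Set
Adj n T x z = Σ ℕ λ k → T k × (z ≡ (x + k) % n ⊎ x ≡ (z + k) % n)

data Reach (n : ℕ) .{{_ : Data.Nat.NonZero n}} (T : ℕ → Set) (x : ℕ) : ℕ → Set where
  here : Reach n T x x
  step : ∀ {y z} → Reach n T x y → Adj n T y z → Reach n T x z

-- directed edge of length k from x to y: (x, x+k mod n)
-- (for k = n/2 the edge (x+n/2, x) is of the same form)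
DirEdge : (n : ℕ) .{{_ : Data.Nat.NonZero n}} → ℕ → ℕ → ℕ → Set
DirEdge n k x y = y ≡ (x + k) % n

-- a digraph on Fin m (arc relation A) is a directed cycle:
-- there is a bijective enumeration σ of its vertices such that
-- A (σ a) (σ b) holds iff b is the cyclic successor of a.
CycSucc : (m : ℕ) → Fin m → Fin m → Set
CycSucc m a b = (suc (toℕ a) ≡ toℕ b) ⊎ (suc (toℕ a) ≡ m × toℕ b ≡ 0)

IsDirectedCycle : (m : ℕ) → (Fin m → Fin m → Set) → Set
IsDirectedCycle m A =
  Σ (Fin m → Fin m) λ σ → Bijective _≡_ _≡_ σ ×
    (∀ a b → (A (σ a) (σ b) → CycSucc m a b) × (CycSucc m a b → A (σ a) (σ b)))

{-# OPTIONS --safe #-}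
-- The stripes φ(1), …, φ(i) connect x and y exactly when x ≡ y (mod gᵢ): every such stripe is a
-- multiple of gᵢ, and conversely, by Bézout, walking along φ(i+1) reaches every residue mod gᵢ
-- inside a residue class mod gᵢ₊₁. So the components C^j inside C^{j+1} (the class of r mod gⱼ₊₁)
-- are the residues mod gⱼ of the points r + a·φ(j+1), 0 ≤ a < m, pairwise distinct because
-- φ(j+1) has order m = gⱼ / gⱼ₊₁ modulo gⱼ. An edge of length φ(j+1) takes the a-th of them to
-- the (a+1 mod m)-th, so G′ is a directed cycle.
module Submission where

open import Defs
open import Data.Nat using (ℕ; zero; suc; _+_; _*_; _∸_; _≤_; _<_; _≤′_; ≤′-refl; ≤′-step; z≤n; s≤s;
  NonZero; ≢-nonZero; ≢-nonZero⁻¹; >-nonZero)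
open import Data.Nat.Properties
open import Data.Nat.DivMod
open import Data.Nat.Divisibility
open import Data.Nat.GCD
open import Data.Nat.Solver using (module +-*-Solver)
open import Data.Fin using (Fin; toℕ; fromℕ<)
open import Data.Fin.Properties using (toℕ-injective; toℕ<n; toℕ-fromℕ<; nonZeroIndex)
open import Data.Product using (Σ; _×_; _,_; proj₁; proj₂; ∃)
open import Data.Sum using (inj₁; inj₂)
open import Function.Definitions using (Injective; Surjective)
open import Relation.Binary.PropositionalEquality
open import Relation.Nullary using (contradiction)
open +-*-Solver
open ≡-Reasoning

%-+-congʳ : ∀ {d a b} c .{{_ : NonZero d}} → a % d ≡ b % d → (a + c) % d ≡ (b + c) % d
%-+-congʳ {d} {a} {b} c a≡b = begin
  (a + c) % d          ≡⟨ %-distribˡ-+ a c d ⟩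
  (a % d + c % d) % d  ≡⟨ cong (λ v → (v + c % d) % d) a≡b ⟩
  (b % d + c % d) % d  ≡⟨ %-distribˡ-+ b c d ⟨
  (b + c) % d          ∎

%-+-congˡ : ∀ {d a b} c .{{_ : NonZero d}} → a % d ≡ b % d → (c + a) % d ≡ (c + b) % d
%-+-congˡ {a = a} {b} c a≡b rewrite +-comm c a | +-comm c b = %-+-congʳ c a≡b

%-*-congˡ : ∀ {d a b} c .{{_ : NonZero d}} → a % d ≡ b % d → (c * a) % d ≡ (c * b) % d
%-*-congˡ {d} {a} {b} c a≡b = begin
  (c * a) % d              ≡⟨ %-distribˡ-* c a d ⟩
  (c % d * (a % d)) % d    ≡⟨ cong (λ v → (c % d * v) % d) a≡b ⟩
  (c % d * (b % d)) % d    ≡⟨ %-distribˡ-* c b d ⟨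
  (c * b) % d              ∎

%≡⇒∣∸ : ∀ {d a b} .{{_ : NonZero d}} → a % d ≡ b % d → d ∣ b ∸ a
%≡⇒∣∸ {d} {a} {b} a≡b = divides (b / d ∸ a / d) (begin
  b ∸ a                                     ≡⟨ cong₂ _∸_ (m≡m%n+[m/n]*n b d) (m≡m%n+[m/n]*n a d) ⟩
  (b % d + b / d * d) ∸ (a % d + a / d * d)
    ≡⟨ cong (λ v → (b % d + b / d * d) ∸ (v + a / d * d)) a≡b ⟩
  (b % d + b / d * d) ∸ (b % d + a / d * d) ≡⟨ [m+n]∸[m+o]≡n∸o (b % d) _ _ ⟩
  b / d * d ∸ a / d * d                     ≡⟨ *-distribʳ-∸ d (b / d) (a / d) ⟨
  (b / d ∸ a / d) * d                       ∎)

[y+k]%n%d≡y%d : ∀ {n d} y {k} .{{_ : NonZero n}} .{{_ : NonZero d}} →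
  d ∣ n → d ∣ k → (y + k) % n % d ≡ y % d
[y+k]%n%d≡y%d {n} {d} y {k} d∣n d∣k = trans (m∣n⇒o%n%m≡o%m d n (y + k) d∣n) (%-remove-+ʳ y d∣k)

gcd-nonZeroʳ : ∀ m n .{{_ : NonZero n}} → NonZero (gcd m n)
gcd-nonZeroʳ m n = ≢-nonZero (gcd[m,n]≢0 m n (inj₂ (≢-nonZero⁻¹ n)))

bézout-% : ∀ m n .{{_ : NonZero n}} → ∃ λ a → (a * m) % n ≡ gcd m n % n
bézout-% m n with Bézout.identity (gcd-GCD m n) | gcd[m,n]∣n m n
... | Bézout.+- x y eq | _ = x , (begin
  (x * m) % n           ≡⟨ cong (_% n) eq ⟨
  (gcd m n + y * n) % n ≡⟨ [m+kn]%n≡m%n (gcd m n) y n ⟩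
  gcd m n % n           ∎)
... | Bézout.-+ x y eq | divides zero n≡0 = contradiction n≡0 (≢-nonZero⁻¹ n)
... | Bézout.-+ x y eq | divides (suc q) n≡[1+q]d = q * x , (begin
  (q * x * m) % n           ≡⟨ [m+kn]%n≡m%n (q * x * m) 1 n ⟨
  (q * x * m + 1 * n) % n   ≡⟨ cong (_% n) regroup ⟩
  (d + q * y * n) % n       ≡⟨ [m+kn]%n≡m%n d (q * y) n ⟩
  d % n                     ∎)
  where
  d = gcd m n
  regroup : q * x * m + 1 * n ≡ d + q * y * n
  regroup = begin
    q * x * m + 1 * n             ≡⟨ cong (λ v → q * x * m + 1 * v) n≡[1+q]d ⟩
    q * x * m + 1 * (suc q * d)   ≡⟨ solve 4 (λ q x m d → q :* x :* m :+ con 1 :* ((con 1 :+ q) :* d)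
                                                       := d :+ q :* (d :+ x :* m)) refl q x m d ⟩
    d + q * (d + x * m)           ≡⟨ cong (λ v → d + q * v) eq ⟩
    d + q * (y * n)               ≡⟨ cong (d +_) (*-assoc q y n) ⟨
    d + q * y * n                 ∎

%-lift : ∀ {d n x y} .{{_ : NonZero d}} .{{_ : NonZero n}} →
  d ∣ n → x % d ≡ y % d → ∃ λ t → (x + t * d) % n ≡ y % n
%-lift {n = n} (divides zero n≡0) _ = contradiction n≡0 (≢-nonZero⁻¹ n)
%-lift {d} {n} {x} {y} (divides (suc q) n≡[1+q]d) x≡y = t , (begin
  (x + t * d) % n     ≡⟨ cong (_% n) regroup ⟩
  (y + x / d * n) % n ≡⟨ [m+kn]%n≡m%n y (x / d) n ⟩
  y % n               ∎)
  where
  t = y / d + x / d * q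
  regroup : x + t * d ≡ y + x / d * n
  regroup = begin
    x + t * d                                   ≡⟨ cong (_+ t * d) (m≡m%n+[m/n]*n x d) ⟩
    x % d + x / d * d + t * d                   ≡⟨ cong (λ v → v + x / d * d + t * d) x≡y ⟩
    y % d + x / d * d + (y / d + x / d * q) * d ≡⟨ solve 5 (λ r a d b q → r :+ a :* d :+ (b :+ a :* q) :* d
                                                     := r :+ b :* d :+ a :* ((con 1 :+ q) :* d))
                                                     refl (y % d) (x / d) d (y / d) q ⟩
    y % d + y / d * d + x / d * (suc q * d)     ≡⟨ cong₂ (λ u v → u + x / d * v) (m≡m%n+[m/n]*n y d) n≡[1+q]d ⟨
    y + x / d * n                               ∎

%-gcd-lift : ∀ k n {x y} .{{_ : NonZero n}} .{{_ : NonZero (gcd k n)}} →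
  x % gcd k n ≡ y % gcd k n → ∃ λ c → (x + c * k) % n ≡ y % n
%-gcd-lift k n {x} {y} x≡y =
  let a , a*k≡gcd = bézout-% k n
      t , x+t*gcd≡y = %-lift (gcd[m,n]∣n k n) x≡y
  in t * a , (begin
  (x + t * a * k) % n     ≡⟨ cong (λ v → (x + v) % n) (*-assoc t a k) ⟩
  (x + t * (a * k)) % n   ≡⟨ %-+-congˡ x (%-*-congˡ t a*k≡gcd) ⟩
  (x + t * gcd k n) % n   ≡⟨ x+t*gcd≡y ⟩
  y % n                   ∎)

module Orbit {m k n : ℕ} .{{_ : NonZero n}} (m*gcd≡n : m * gcd k n ≡ n) where

  instance _ = gcd-nonZeroʳ k n

  orbit : ℕ → ℕ → ℕ
  orbit x a = (x + a * k) % n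

  n∣m*k : n ∣ m * k
  n∣m*k = subst (_∣ m * k) m*gcd≡n (*-monoʳ-∣ m (gcd[m,n]∣m k n))

  n∣t*k⇒m∣t : ∀ t → n ∣ t * k → m ∣ t
  n∣t*k⇒m∣t t n∣t*k = *-cancelʳ-∣ (gcd k n)
    (subst₂ _∣_ (sym m*gcd≡n) (sym (c*gcd[m,n]≡gcd[cm,cn] t k n)) (gcd-greatest n∣t*k (n∣m*n t)))

  orbit-injective-≤ : ∀ x {a b} → a ≤ b → b < m → orbit x a ≡ orbit x b → a ≡ b
  orbit-injective-≤ x {a} {b} a≤b b<m xa≡xb = ≤-antisym a≤b (m∸n≡0⇒m≤n b∸a≡0)
    where
    instance _ = >-nonZero (≤-<-trans z≤n b<m)
    m∣b∸a : m ∣ b ∸ a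
    m∣b∸a = n∣t*k⇒m∣t (b ∸ a)
      (subst (n ∣_) (trans ([m+n]∸[m+o]≡n∸o x _ _) (sym (*-distribʳ-∸ k b a))) (%≡⇒∣∸ xa≡xb))
    b∸a≡0 : b ∸ a ≡ 0
    b∸a≡0 = trans (sym (m<n⇒m%n≡m (≤-<-trans (m∸n≤m b a) b<m))) (n∣m⇒m%n≡0 (b ∸ a) m m∣b∸a)

  orbit-injective : ∀ x {a b} → a < m → b < m → orbit x a ≡ orbit x b → a ≡ b
  orbit-injective x {a} {b} a<m b<m xa≡xb with ≤-total a b
  ... | inj₁ a≤b = orbit-injective-≤ x a≤b b<m xa≡xb
  ... | inj₂ b≤a = sym (orbit-injective-≤ x b≤a a<m (sym xa≡xb))

  orbit-period : ∀ x → orbit x m ≡ orbit x 0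
  orbit-period x = trans (%-remove-+ʳ x n∣m*k) (cong (_% n) (sym (+-identityʳ x)))

  orbit-suc : ∀ x a {z} → z % n ≡ orbit x a → (z + k) % n ≡ orbit x (suc a)
  orbit-suc x a {z} z≡xa = trans (%-+-congʳ k z≡xa)
    (cong (_% n) (trans (+-assoc x (a * k) k) (cong (x +_) (+-comm (a * k) k))))

  orbit-%m : ∀ x c .{{_ : NonZero m}} → orbit x (c % m) ≡ orbit x c
  orbit-%m x c = begin
    (x + c % m * k) % n                   ≡⟨ %-remove-+ʳ (x + c % m * k) (∣n⇒∣m*n (c / m) n∣m*k) ⟨
    (x + c % m * k + c / m * (m * k)) % n ≡⟨ cong (_% n) regroup ⟩
    (x + c * k) % n                       ∎
    where
    regroup : x + c % m * k + c / m * (m * k) ≡ x + c * k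
    regroup = begin
      x + c % m * k + c / m * (m * k) ≡⟨ solve 5 (λ x r q m k → x :+ r :* k :+ q :* (m :* k)
                                                   := x :+ (r :+ q :* m) :* k) refl x (c % m) (c / m) m k ⟩
      x + (c % m + c / m * m) * k     ≡⟨ cong (λ v → x + v * k) (m≡m%n+[m/n]*n c m) ⟨
      x + c * k                       ∎

  orbit-covers : ∀ {x y} .{{_ : NonZero m}} → x % gcd k n ≡ y % gcd k n →
    ∃ λ (a : Fin m) → orbit x (toℕ a) ≡ y % n
  orbit-covers {x} x≡y =
    let c , x+ck≡y = %-gcd-lift k n x≡y
    in fromℕ< (m%n<n c m) ,
       trans (cong (orbit x) (toℕ-fromℕ< (m%n<n c m))) (trans (orbit-%m x c) x+ck≡y)

  CycSucc⇒orbit-suc : ∀ x (a b : Fin m) → CycSucc m a b → orbit x (suc (toℕ a)) ≡ orbit x (toℕ b)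
  CycSucc⇒orbit-suc x a b (inj₁ 1+a≡b) = cong (orbit x) 1+a≡b
  CycSucc⇒orbit-suc x a b (inj₂ (1+a≡m , b≡0)) =
    trans (cong (orbit x) 1+a≡m) (trans (orbit-period x) (cong (orbit x) (sym b≡0)))

  orbit-suc⇒CycSucc : ∀ x (a b : Fin m) → orbit x (suc (toℕ a)) ≡ orbit x (toℕ b) → CycSucc m a b
  orbit-suc⇒CycSucc x a b x[1+a]≡xb with m≤n⇒m<n∨m≡n (toℕ<n a)
  ... | inj₁ 1+a<m = inj₁ (orbit-injective x 1+a<m (toℕ<n b) x[1+a]≡xb)
  ... | inj₂ 1+a≡m = inj₂ (1+a≡m , sym (orbit-injective x (≤-<-trans z≤n (toℕ<n b)) (toℕ<n b)
          (trans (sym (orbit-period x)) (trans (cong (orbit x) (sym 1+a≡m)) x[1+a]≡xb))))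

Reach-trans : ∀ {n} .{{_ : NonZero n}} {T x y z} → Reach n T x y → Reach n T y z → Reach n T x z
Reach-trans x⇝y here         = x⇝y
Reach-trans x⇝y (step y⇝z e) = step (Reach-trans x⇝y y⇝z) e

Reach-mono : ∀ {n} .{{_ : NonZero n}} {T T′ : ℕ → Set} {x y} →
  (∀ {k} → T k → T′ k) → Reach n T x y → Reach n T′ x y
Reach-mono T⊆T′ here                   = here
Reach-mono T⊆T′ (step x⇝y (k , Tk , e)) = step (Reach-mono T⊆T′ x⇝y) (k , T⊆T′ Tk , e)

Reach-+-* : ∀ {n} .{{_ : NonZero n}} {T x k} → x < n → T k → ∀ c → Reach n T x ((x + c * k) % n)
Reach-+-* {n} {x = x} x<n Tk zero =
  subst (Reach _ _ x) (trans (sym (m<n⇒m%n≡m x<n)) (cong (_% n) (sym (+-identityʳ x)))) here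
Reach-+-* {n} {x = x} {k} x<n Tk (suc c) = step (Reach-+-* x<n Tk c) (k , Tk , inj₁ (begin
  (x + suc c * k) % n          ≡⟨ cong (_% n) (trans (cong (x +_) (+-comm k (c * k)))
                                                     (sym (+-assoc x (c * k) k))) ⟩
  (x + c * k + k) % n          ≡⟨ %-+-congʳ k (m%n%n≡m%n (x + c * k) n) ⟨
  ((x + c * k) % n + k) % n    ∎))

Reach⇒%≡ : ∀ {n d} .{{_ : NonZero n}} .{{_ : NonZero d}} {T x y} →
  d ∣ n → (∀ {k} → T k → d ∣ k) → Reach n T x y → x % d ≡ y % d
Reach⇒%≡ d∣n d∣T here = refl
Reach⇒%≡ {d = d} d∣n d∣T (step {y} x⇝y (k , Tk , inj₁ z≡y+k)) =
  trans (Reach⇒%≡ d∣n d∣T x⇝y) (sym (trans (cong (_% d) z≡y+k) ([y+k]%n%d≡y%d y d∣n (d∣T Tk))))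
Reach⇒%≡ {d = d} d∣n d∣T (step {z = z} x⇝y (k , Tk , inj₂ y≡z+k)) =
  trans (Reach⇒%≡ d∣n d∣T x⇝y) (trans (cong (_% d) y≡z+k) ([y+k]%n%d≡y%d z d∣n (d∣T Tk)))

module Stripes (n : ℕ) .{{_ : NonZero n}} (φ : ℕ → ℕ) where

  g-nonZero : ∀ i → NonZero (g n φ i)
  g-nonZero zero    = ≢-nonZero (≢-nonZero⁻¹ n)
  g-nonZero (suc i) = gcd-nonZeroʳ (φ (suc i)) (g n φ i) {{g-nonZero i}}

  g∣g : ∀ {t i} → t ≤′ i → g n φ i ∣ g n φ t
  g∣g ≤′-refl                   = ∣-refl
  g∣g {i = suc i} (≤′-step t≤i) = ∣-trans (gcd[m,n]∣n (φ (suc i)) (g n φ i)) (g∣g t≤i)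

  g∣n : ∀ i → g n φ i ∣ n
  g∣n i = g∣g {i = i} (≤⇒≤′ z≤n)

  g∣Prefix : ∀ {i k} → Prefix φ i k → g n φ i ∣ k
  g∣Prefix (suc t , _ , 1+t≤i , refl) = ∣-trans (g∣g (≤⇒≤′ 1+t≤i)) (gcd[m,n]∣m (φ (suc t)) (g n φ t))

  φ∈Prefix : ∀ i → Prefix φ (suc i) (φ (suc i))
  φ∈Prefix i = suc i , s≤s z≤n , ≤-refl , refl

  Prefix-suc : ∀ {i k} → Prefix φ i k → Prefix φ (suc i) k
  Prefix-suc (t , 1≤t , t≤i , k≡φt) = t , 1≤t , m≤n⇒m≤1+n t≤i , k≡φt

  %n%g≡%g : ∀ i x → (x % n % g n φ i) {{g-nonZero i}} ≡ (x % g n φ i) {{g-nonZero i}}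
  %n%g≡%g i x = m∣n⇒o%n%m≡o%m (g n φ i) n x {{g-nonZero i}} (g∣n i)

  Reach⇒%g≡ : ∀ i {x y} → Reach n (Prefix φ i) x y →
    (x % g n φ i) {{g-nonZero i}} ≡ (y % g n φ i) {{g-nonZero i}}
  Reach⇒%g≡ i = Reach⇒%≡ {{_}} {{g-nonZero i}} (g∣n i) g∣Prefix

  %g≡⇒Reach : ∀ i {x y} → x < n → y < n →
    (x % g n φ i) {{g-nonZero i}} ≡ (y % g n φ i) {{g-nonZero i}} → Reach n (Prefix φ i) x y
  %g≡⇒Reach zero {x} x<n y<n x≡y = subst (Reach n (Prefix φ zero) x) x≡y′ here
    where
    x≡y′ = trans (sym (m<n⇒m%n≡m {{g-nonZero 0}} x<n)) (trans x≡y (m<n⇒m%n≡m {{g-nonZero 0}} y<n))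
  %g≡⇒Reach (suc i) {x} {y} x<n y<n x≡y =
    let instance _ = g-nonZero i
                 _ = g-nonZero (suc i)
        c , x+cφ≡y = %-gcd-lift (φ (suc i)) (g n φ i) x≡y
    in Reach-trans (Reach-+-* x<n (φ∈Prefix i) c)
         (Reach-mono Prefix-suc (%g≡⇒Reach i (m%n<n _ n) y<n (trans (%n%g≡%g i _) x+cφ≡y)))

module Components
  (n : ℕ) .{{_ : NonZero n}} (φ : ℕ → ℕ) (j r : ℕ) (r<n : r < n)
  (m : ℕ) (m*g≡g : m * g n φ (suc j) ≡ g n φ j)
  (rep : Fin m → ℕ) (rep<n : ∀ u → rep u < n)
  (r⇝rep : ∀ u → Reach n (Prefix φ (suc j)) r (rep u))
  (rep-injective : ∀ u u′ → Reach n (Prefix φ j) (rep u) (rep u′) → u ≡ u′)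
  (rep-covers : ∀ x → x < n → Reach n (Prefix φ (suc j)) r x →
    Σ (Fin m) λ u → Reach n (Prefix φ j) (rep u) x)
  where

  open Stripes n φ

  F G : ℕ
  F = φ (suc j)
  G = g n φ j

  instance _ = g-nonZero j
  open Orbit {m} {F} {G} m*g≡g

  Arc : Fin m → Fin m → Set
  Arc u v = Σ ℕ λ x → Σ ℕ λ y →
    x < n × Reach n (Prefix φ j) (rep u) x × Reach n (Prefix φ j) (rep v) y × DirEdge n F x y

  Arc⇒%≡ : ∀ {u v} → Arc u v → (rep u + F) % G ≡ rep v % G
  Arc⇒%≡ {u} {v} (x , y , _ , u⇝x , v⇝y , y≡x+F) = begin
    (rep u + F) % G     ≡⟨ %-+-congʳ {G} F (Reach⇒%g≡ j u⇝x) ⟩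
    (x + F) % G         ≡⟨ %n%g≡%g j (x + F) ⟨
    (x + F) % n % G     ≡⟨ cong (_% G) y≡x+F ⟨
    y % G               ≡⟨ Reach⇒%g≡ j v⇝y ⟨
    rep v % G           ∎

  %≡⇒Arc : ∀ {u v} → (rep u + F) % G ≡ rep v % G → Arc u v
  %≡⇒Arc {u} {v} u+F≡v = rep u , (rep u + F) % n , rep<n u , here ,
    %g≡⇒Reach j (rep<n v) (m%n<n _ n) (trans (sym u+F≡v) (sym (%n%g≡%g j (rep u + F)))) , refl

  component-of-orbit : (a : Fin m) → Σ (Fin m) λ u → Reach n (Prefix φ j) (rep u) ((r + toℕ a * F) % n)
  component-of-orbit a = rep-covers _ (m%n<n (r + toℕ a * F) n) (Reach-+-* r<n (φ∈Prefix j) (toℕ a))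

  σ : Fin m → Fin m
  σ a = proj₁ (component-of-orbit a)

  rep-σ : (a : Fin m) → rep (σ a) % G ≡ orbit r (toℕ a)
  rep-σ a = trans (Reach⇒%g≡ j (proj₂ (component-of-orbit a))) (%n%g≡%g j (r + toℕ a * F))

  σ-injective : Injective _≡_ _≡_ σ
  σ-injective {a} {b} σa≡σb = toℕ-injective (orbit-injective r (toℕ<n a) (toℕ<n b)
    (trans (sym (rep-σ a)) (trans (cong (λ u → rep u % G) σa≡σb) (rep-σ b))))

  σ-surjective : Surjective _≡_ _≡_ σ
  σ-surjective u = a , λ { refl → σa≡u }
    where
    instance _ = nonZeroIndex u
    orbit-hits-u = orbit-covers (Reach⇒%g≡ (suc j) (r⇝rep u))
    a = proj₁ orbit-hits-u
    σa≡u : σ a ≡ u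
    σa≡u = rep-injective (σ a) u
      (%g≡⇒Reach j (rep<n (σ a)) (rep<n u) (trans (rep-σ a) (proj₂ orbit-hits-u)))

  Arc⇒CycSucc : ∀ a b → Arc (σ a) (σ b) → CycSucc m a b
  Arc⇒CycSucc a b arc = orbit-suc⇒CycSucc r a b
    (trans (sym (orbit-suc r (toℕ a) (rep-σ a))) (trans (Arc⇒%≡ arc) (rep-σ b)))

  CycSucc⇒Arc : ∀ a b → CycSucc m a b → Arc (σ a) (σ b)
  CycSucc⇒Arc a b a→b = %≡⇒Arc
    (trans (orbit-suc r (toℕ a) (rep-σ a)) (trans (CycSucc⇒orbit-suc r a b a→b) (sym (rep-σ b))))

lemma4 : (n : ℕ) → 3 ≤ n → (φ : ℕ → ℕ) → IsPermOf (n / 2) φ →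
    (ℓ : ℕ) → ℓ ≤ n / 2 → g n φ ℓ ≡ 1 → (∀ i → i < ℓ → g n φ i ≢ 1) →
    (∀ i → i < ℓ → g n φ (suc i) < g n φ i) →
    (j : ℕ) → j < ℓ →
    .{{_ : NonZero n}} →
    (r : ℕ) → r < n →
    (m : ℕ) → m * g n φ (suc j) ≡ g n φ j →
    (rep : Fin m → ℕ) →
    (∀ u → rep u < n) →
    (∀ u → Reach n (Prefix φ (suc j)) r (rep u)) →
    (∀ u u' → Reach n (Prefix φ j) (rep u) (rep u') → u ≡ u') →
    (∀ x → x < n → Reach n (Prefix φ (suc j)) r x →
      Σ (Fin m) λ u → Reach n (Prefix φ j) (rep u) x) →
    IsDirectedCycle m (λ u v → Σ ℕ λ x → Σ ℕ λ y →
      x < n × Reach n (Prefix φ j) (rep u) x × Reach n (Prefix φ j) (rep v) y ×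
      DirEdge n (φ (suc j)) x y)
lemma4 n _ φ _ _ _ _ _ _ j _ r r<n m m*g≡g rep rep<n r⇝rep rep-injective rep-covers =
  σ , (σ-injective , σ-surjective) , λ a b → Arc⇒CycSucc a b , CycSucc⇒Arc a b
  where open Components n φ j r r<n m m*g≡g rep rep<n r⇝rep rep-injective rep-covers
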